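{- Let $L$ be a finite set of at least three list items, let $x\ne y$ be two items of $L$, let $M>0$ be an integer, and let ${A}$ be a deterministic projective $M$-regular list update algorithm on $L$ (with some fixed initial list state). Let $\hat M$ be an integer with $\hat M>M$ and $\hat M\ge 3$, let $K,T$ be positive integers, and let $\phi$, $H$, $\Lambda$ be as defined in the context. If $(i,j)$ is a good state, then \[\sum_{\lambda\in\Lambda}{A}_\lambda(i,j)\ge 16.\]
   Context: List update problem, partial cost model: a list state is a linear order of $L$. A deterministic algorithm with fixed initial list is identified with a function $S$ mapping each finite request sequence $\sigma$ to the list state $S(\sigma)$ after serving $\sigma$. The cost of serving a request $z$ after the prefix $\sigma$ is the minimum number of exchanges of adjacent items transforming $S(\sigma)$ into $S(\sigma z)$ plus $p-1$, where $p$ is the position of $z$ in $S(\sigma z)$. The algorithm is projective if the relative order $S_{uv}(\sigma)$ of any two items $u,v$ in $S(\sigma)$ equals $S_{uv}(\sigma_{uv})$, where $\sigma_{uv}$ is the subsequence of requests to $u$ or $v$; it is $M$-regular if for every item $u$ and every $\sigma$, $u$ is at the front of $S(\sigma u^M)$. Here $u^m$ denotes $m$ consecutive requests to $u$. Define $\phi:=x^{\hat M}\,y\,x^{\hat M}\,y^{\hat M}\,x\,y^{\hat M}\,x^{\hat M}\,y\,x\,y\,x^{\hat M}\,y^{\hat M}\,x\,y\,x\,y^{\hat M}$, and $H:=|\phi|/2=4\hat M+4$ (the number of requests to $x$, and to $y$, in $\phi$). Let $\Lambda=\{x^{\hat M+t}y^{\hat M+h}\phi^K: 0\le h<H,\ 0\le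 t<HT\}$. A request sequence $\sigma$ ends at state $(i,j)$ if it contains exactly $i$ requests to $x$ and $j$ requests to $y$. A sequence $\lambda$ passes $(i,j)$ if $\lambda=\sigma\tau$ with $\tau$ nonempty and $\sigma$ ending at $(i,j)$; the request in $\lambda$ after $(i,j)$ is then the first request of $\tau$. ${A}_\lambda(i,j)$ is the cost of ${A}$ for serving the request in $\lambda$ after $(i,j)$ (while serving $\lambda$), and $0$ if $\lambda$ does not pass $(i,j)$. A state $(i,j)$ is good if for every proper prefix $\sigma$ of $\phi$ (i.e. $0\le|\sigma|<2H$) there is exactly one $\lambda=x^{\hat M+t}y^{\hat M+h}\phi^K\in\Lambda$ such that, for some $0\le k<K$, its prefix $x^{\hat M+t}y^{\hat M+h}\phi^k\sigma$ ends at $(i,j)$. -}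

module Defs where

open import Data.Nat using (ℕ; zero; suc; _+_; _*_; _<_; _<ᵇ_)
open import Data.Fin using (Fin)
open import Data.Nat.Properties renaming (_≟_ to _ℕ≟_) using ()
open import Data.Bool.ListAction using (any)
open import Data.Nat.ListAction using (sum)
open import Data.Fin.Properties using (_≟_)
open import Data.Bool using (Bool; true; false; if_then_else_; _∨_; _∧_)
open import Data.List using (List; []; _∷_; _++_; _∷ʳ_; length; filter; upTo; allFin; map; replicate; concat; take; drop)
open import Data.List.Properties using (≡-dec)
open import Data.List.Relation.Binary.Permutation.Propositional using (_↭_)
open import Data.Product using (Σ; ∃; ∃-syntax; _×_; _,_)
open import Relation.Binary.PropositionalEquality using (_≡_)
open import Relation.Nullary.Decidable using (⌊_⌋; _⊎-dec_)

-- Items are Fin n, request sequences and list states are lists of items.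

count : ∀ {n} → Fin n → List (Fin n) → ℕ
count u [] = 0
count u (w ∷ σ) = if ⌊ w ≟ u ⌋ then suc (count u σ) else count u σ

swapAt : ∀ {n} → ℕ → List (Fin n) → List (Fin n)
swapAt zero (a ∷ b ∷ r) = b ∷ a ∷ r
swapAt zero l = l
swapAt (suc i) [] = []
swapAt (suc i) (a ∷ r) = a ∷ swapAt i r

reachWithin : ∀ {n} → ℕ → List (Fin n) → List (Fin n) → Bool
reachWithin zero s t = ⌊ ≡-dec _≟_ s t ⌋
reachWithin (suc k) s t =
  reachWithin k s t ∨ any (λ i → reachWithin k (swapAt i s) t) (upTo (length s))

-- least k < b with f k true (b if none)
leastBelow : (ℕ → Bool) → ℕ → ℕ
leastBelow f zero = zero
leastBelow f (suc b) = if f zero then zero else suc (leastBelow (λ k → f (suc k)) b)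

-- minimum number of adjacent exchanges transforming s into t
-- (for permutations of the same list this is < length s * length s + 1)
swapDist : ∀ {n} → List (Fin n) → List (Fin n) → ℕ
swapDist s t = leastBelow (λ k → reachWithin k s t) (suc (length s * length s))

-- p - 1, where p is the (1-based) position of z in the list
pos₀ : ∀ {n} → Fin n → List (Fin n) → ℕ
pos₀ z [] = 0
pos₀ z (a ∷ r) = if ⌊ a ≟ z ⌋ then 0 else suc (pos₀ z r)

-- deterministic algorithm: σ ↦ S(σ); every S(σ) is a linear order of L = Fin n.
-- The initial list state is S [].
record Algorithm (n : ℕ) : Set where
  field
    S      : List (Fin n) → List (Fin n)
    linear : ∀ σ → S σ ↭ allFin n
open Algorithm public

serveCost : ∀ {n} → Algorithm n → List (Fin n) → Fin n → ℕ
serveCost A σ z = swapDist (S A σ) (S A (σ ∷ʳ z)) + pos₀ z (S A (σ ∷ʳ z))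

restrict : ∀ {n} → Fin n → Fin n → List (Fin n) → List (Fin n)
restrict u v = filter (λ w → (w ≟ u) ⊎-dec (w ≟ v))

Projective : ∀ {n} → Algorithm n → Set
Projective A = ∀ u v σ → restrict u v (S A σ) ≡ restrict u v (S A (restrict u v σ))

Regular : ∀ {n} → ℕ → Algorithm n → Set
Regular M A = ∀ u σ → ∃[ r ] S A (σ ++ replicate M u) ≡ u ∷ r

phi : ∀ {n} → Fin n → Fin n → ℕ → List (Fin n)
phi x y Mh =
  replicate Mh x ++ (y ∷ []) ++ replicate Mh x ++ replicate Mh y ++ (x ∷ []) ++
  replicate Mh y ++ replicate Mh x ++ (y ∷ []) ++ (x ∷ []) ++ (y ∷ []) ++
  replicate Mh x ++ replicate Mh y ++ (x ∷ []) ++ (y ∷ []) ++ (x ∷ []) ++ replicate Mh y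

H : ℕ → ℕ
H Mh = 4 * Mh + 4

phiPow : ∀ {n} → Fin n → Fin n → ℕ → ℕ → List (Fin n)
phiPow x y Mh k = concat (replicate k (phi x y Mh))

preamble : ∀ {n} → Fin n → Fin n → ℕ → ℕ → ℕ → List (Fin n)
preamble x y Mh t h = replicate (Mh + t) x ++ replicate (Mh + h) y

lam : ∀ {n} → Fin n → Fin n → ℕ → ℕ → ℕ → ℕ → List (Fin n)
lam x y Mh K t h = preamble x y Mh t h ++ phiPow x y Mh K

EndsAt : ∀ {n} → Fin n → Fin n → List (Fin n) → ℕ → ℕ → Set
EndsAt x y σ i j = count x σ ≡ i × count y σ ≡ j

-- A_λ(i,j) for λ over {x,y}: a prefix ending at (i,j) has length i+j
costAt : ∀ {n} → Algorithm n → Fin n → Fin n → List (Fin n) → ℕ → ℕ → ℕ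
costAt A x y λs i j with drop (i + j) λs
... | [] = 0
... | z ∷ _ =
  if ⌊ count x (take (i + j) λs) ℕ≟ i ⌋
     ∧ ⌊ count y (take (i + j) λs) ℕ≟ j ⌋
  then serveCost A (take (i + j) λs) z else 0

-- Σ_{λ ∈ Λ} A_λ(i,j), Λ indexed (injectively) by t < H T, h < H
sumΛ : ∀ {n} → Algorithm n → Fin n → Fin n → ℕ → ℕ → ℕ → ℕ → ℕ → ℕ
sumΛ A x y Mh K T i j =
  sum (map (λ t → sum (map (λ h → costAt A x y (lam x y Mh K t h) i j) (upTo (H Mh))))
           (upTo (H Mh * T)))

Hit : ∀ {n} → Fin n → Fin n → ℕ → ℕ → ℕ → ℕ → ℕ → ℕ → ℕ → Set
Hit x y Mh K m t h i j =
  ∃[ k ] (k < K × EndsAt x y (preamble x y Mh t h ++ phiPow x y Mh k ++ take m (phi x y Mh)) i j)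

Good : ∀ {n} → Fin n → Fin n → ℕ → ℕ → ℕ → ℕ → ℕ → Set
Good x y Mh K T i j =
  ∀ m → m < 2 * H Mh →
    Σ (ℕ × ℕ) λ { (t , h) →
      (t < H Mh * T × h < H Mh × Hit x y Mh K m t h i j) ×
      (∀ t' h' → t' < H Mh * T → h' < H Mh → Hit x y Mh K m t' h' i j →
         t' ≡ t × h' ≡ h) }

-- Fix a third item w. By M-regularity, w is ahead of u after u^a w^M u^d for d = 0 and behind u
-- for d ≥ M; so for u = x and u = y there are thresholds p, q < M such that w stays ahead for
-- d ≤ p (resp. q) and is overtaken at d = p + 1 (resp. q + 1). Let Q = Q₁ Q₂ be a request
-- sequence over {x, y} where Q₂ has exactly q + 1 requests to y and at most p to x. By
-- projectivity the x-y order after Q is the one after Q₁ w^M Q₂, where w is ahead of x and y is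
-- ahead of w, since these two orders are the ones after x^a w^M x^d and y^b w^M y^(q+1). So y is
-- ahead of x after Q (and symmetrically), and a request to the item behind costs at least 1.
-- Whatever p and q are, this happens at 16 positions of φ. Since (i, j) is good, each of them is
-- passed at (i, j) by some λ_{t,h}, and (t, h) determines the position, namely as
-- (i + j - |x^{M̂+t} y^{M̂+h}|) mod |φ|; so the sum has 16 distinct terms that are at least 1.

module Submission where

open import Algebra.Properties.CommutativeSemigroup using (x∙yz≈y∙xz)
open import Data.Bool using (Bool; true; false; if_then_else_)
open import Data.Empty using (⊥-elim)
open import Data.Fin using (Fin; zero; suc)
open import Data.Fin.Properties using (_≟_)
open import Data.List using (List; []; _∷_; _++_; _∷ʳ_; concat; length; head; replicate; take; drop; map; upTo)
open import Data.List.Properties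
  using (++-assoc; ++-identityʳ; length-++; length-map; length-replicate; concat-++; take++drop≡id;
         upTo-∷ʳ; map-++; ≡-dec; filter-accept; filter-reject; filter-all; filter-none; filter-++; filter-≐)
open import Data.List.Membership.Propositional using (_∈_)
open import Data.List.Membership.Propositional.Properties using (∈-allFin)
open import Data.List.Relation.Binary.Permutation.Propositional using (↭-sym)
open import Data.List.Relation.Binary.Permutation.Propositional.Properties using (∈-resp-↭)
open import Data.List.Relation.Unary.All as All using (All; []; _∷_)
open import Data.List.Relation.Unary.All.Properties using (concat⁺; replicate⁺; ++⁺; ++⁻ˡ; ++⁻ʳ)
open import Data.List.Relation.Unary.AllPairs using ([]; _∷_)
import Data.List.Relation.Unary.AllPairs as AllPairs using (map)
import Data.List.Relation.Unary.AllPairs.Properties as AllPairs using (map⁺)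
open import Data.List.Relation.Unary.Any using (here; there)
open import Data.List.Relation.Unary.Linked using (linked?)
open import Data.List.Relation.Unary.Linked.Properties using (Linked⇒AllPairs)
open import Data.List.Relation.Unary.Unique.Propositional using (Unique)
open import Data.Maybe using (Maybe; just)
import Data.Maybe.Properties as Maybe
open import Data.Maybe.Properties using (just-injective)
open import Data.Nat using (ℕ; zero; suc; _+_; _*_; _∸_; _<_; _≤_; z≤n; s≤s; _<?_) renaming (_≟_ to _ℕ≟_)
open import Data.Nat.DivMod using (_%_; [m+kn]%n≡m%n; m<n⇒m%n≡m)
open import Data.Nat.ListAction using (sum)
open import Data.Nat.ListAction.Properties using (sum-++)
open import Data.Nat.Properties
  using (+-assoc; +-comm; +-suc; +-identityʳ; +-commutativeSemigroup; +-mono-≤; +-monoʳ-<;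
         ≤-refl; ≤-reflexive; ≤-trans; ≤-pred; <-trans; ≤-<-trans; <⇒≤; <⇒≢; ≤∧≢⇒<;
         m≤m+n; m≤n+m; m<m+n; m<n⇒m<1+n; m∸n≤m; m∸n+n≡m; m+n∸n≡m; m+n∸m≡n; m+[n∸m]≡n)
open import Data.Nat.Tactic.RingSolver using (solve-∀)
open import Data.Product using (Σ; ∃-syntax; _×_; _,_; proj₁; proj₂; map₂; uncurry)
open import Data.Product.Properties using () renaming (≡-dec to ×-≡-dec)
open import Data.Sum using (_⊎_; inj₁; inj₂; [_,_]) renaming (swap to ⊎-swap)
open import Function using (_∘′_)
open import Relation.Binary.Definitions using (DecidableEquality)
open import Relation.Binary.PropositionalEquality hiding ([_])
open import Relation.Nullary using (¬_; Dec; yes; no)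
open import Relation.Nullary.Decidable using (True; toWitness; ⌊_⌋; toSum; _⊎-dec_; isYes≗does; dec-true; dec-false)
open import Relation.Unary using (Decidable)

open import Defs

replicate-+ : ∀ {a} {A : Set a} m n (c : A) → replicate (m + n) c ≡ replicate m c ++ replicate n c
replicate-+ zero    n c = refl
replicate-+ (suc m) n c = cong (c ∷_) (replicate-+ m n c)

⌊⌋-false : ∀ {p} {P : Set p} (P? : Dec P) → ¬ P → ⌊ P? ⌋ ≡ false
⌊⌋-false P? ¬p = trans (isYes≗does P?) (dec-false P? ¬p)

⌊⌋-true : ∀ {p} {P : Set p} (P? : Dec P) → P → ⌊ P? ⌋ ≡ true
⌊⌋-true P? p = trans (isYes≗does P?) (dec-true P? p)

take-length-++ : ∀ {a} {X : Set a} (u v : List X) → take (length u) (u ++ v) ≡ u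
take-length-++ []      v = refl
take-length-++ (a ∷ u) v = cong (a ∷_) (take-length-++ u v)

drop-length-++ : ∀ {a} {X : Set a} (u v : List X) → drop (length u) (u ++ v) ≡ v
drop-length-++ []      v = refl
drop-length-++ (a ∷ u) v = drop-length-++ u v

first-failure : ∀ {P : ℕ → Set} → (∀ d → Dec (P d)) → P 0 → ∀ N → ¬ P N →
                ∃[ p ] p < N × (∀ d → d ≤ p → P d) × ¬ P (suc p)
first-failure         P? P0 zero    ¬PN = ⊥-elim (¬PN P0)
first-failure {P} P? P0 (suc N) ¬PN with P? 1
... | no ¬P1 = 0 , s≤s z≤n , (λ { zero _ → P0 }) , ¬P1
... | yes P1 with first-failure {λ d → P (suc d)} (λ d → P? (suc d)) P1 N ¬PN
...   | p , p<N , below , ¬P = suc p , s≤s p<N , below′ , ¬P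
  where
  below′ : ∀ d → d ≤ suc p → P d
  below′ zero    _         = P0
  below′ (suc d) (s≤s d≤p) = below d d≤p

classify : ∀ n → n ≡ 0 ⊎ n ≡ 1 ⊎ 2 ≤ n
classify zero          = inj₁ refl
classify (suc zero)    = inj₂ (inj₁ refl)
classify (suc (suc n)) = inj₂ (inj₂ (s≤s (s≤s z≤n)))

at-least-one : ∀ {n} → n ≡ 1 ⊎ 2 ≤ n → 1 ≤ n
at-least-one (inj₁ refl) = s≤s z≤n
at-least-one (inj₂ 2≤n)  = <⇒≤ 2≤n

Σ< : ℕ → (ℕ → ℕ) → ℕ
Σ< N f = sum (map f (upTo N))

Σ<-suc : ∀ N f → Σ< (suc N) f ≡ Σ< N f + f N
Σ<-suc N f = begin
  sum (map f (upTo (suc N)))          ≡⟨ cong (sum ∘′ map f) (sym (upTo-∷ʳ N)) ⟩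
  sum (map f (upTo N ++ N ∷ []))      ≡⟨ cong sum (map-++ f (upTo N) (N ∷ [])) ⟩
  sum (map f (upTo N) ++ f N ∷ [])    ≡⟨ sum-++ (map f (upTo N)) (f N ∷ []) ⟩
  Σ< N f + (f N + 0)                  ≡⟨ cong (Σ< N f +_) (+-identityʳ (f N)) ⟩
  Σ< N f + f N                        ∎
  where open ≡-Reasoning

Σ<-cong : ∀ N {f g} → (∀ t → t < N → f t ≡ g t) → Σ< N f ≡ Σ< N g
Σ<-cong zero    f≗g = refl
Σ<-cong (suc N) {f} {g} f≗g = begin
  Σ< (suc N) f    ≡⟨ Σ<-suc N f ⟩
  Σ< N f + f N    ≡⟨ cong₂ _+_ (Σ<-cong N (λ t t<N → f≗g t (m<n⇒m<1+n t<N))) (f≗g N ≤-refl) ⟩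
  Σ< N g + g N    ≡⟨ Σ<-suc N g ⟨
  Σ< (suc N) g    ∎
  where open ≡-Reasoning

Σ<-excess : ∀ N {f g} a δ → a < N → (∀ t → t < N → t ≢ a → f t ≡ g t) → f a ≡ δ + g a → Σ< N f ≡ δ + Σ< N g
Σ<-excess (suc N) {f} {g} a δ a<N f≗g fa with a ℕ≟ N
... | yes refl = begin
  Σ< (suc a) f         ≡⟨ Σ<-suc a f ⟩
  Σ< a f + f a         ≡⟨ cong₂ _+_ (Σ<-cong a (λ t t<a → f≗g t (m<n⇒m<1+n t<a) (<⇒≢ t<a))) fa ⟩
  Σ< a g + (δ + g a)   ≡⟨ x∙yz≈y∙xz +-commutativeSemigroup (Σ< a g) δ (g a) ⟩
  δ + (Σ< a g + g a)   ≡⟨ cong (δ +_) (Σ<-suc a g) ⟨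
  δ + Σ< (suc a) g     ∎
  where open ≡-Reasoning
... | no a≢N = begin
  Σ< (suc N) f         ≡⟨ Σ<-suc N f ⟩
  Σ< N f + f N         ≡⟨ cong₂ _+_ (Σ<-excess N a δ (≤∧≢⇒< (≤-pred a<N) a≢N) (λ t t<N → f≗g t (m<n⇒m<1+n t<N)) fa)
                                   (f≗g N ≤-refl (a≢N ∘′ sym)) ⟩
  δ + Σ< N g + g N     ≡⟨ +-assoc δ _ _ ⟩
  δ + (Σ< N g + g N)   ≡⟨ cong (δ +_) (Σ<-suc N g) ⟨
  δ + Σ< (suc N) g     ∎
  where open ≡-Reasoning

Σ² : ℕ → ℕ → (ℕ → ℕ → ℕ) → ℕ
Σ² N₁ N₂ f = Σ< N₁ (λ t → Σ< N₂ (f t))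

_≟²_ : DecidableEquality (ℕ × ℕ)
_≟²_ = ×-≡-dec _ℕ≟_ _ℕ≟_

punch : ℕ × ℕ → (ℕ → ℕ → ℕ) → ℕ → ℕ → ℕ
punch p f t h = if ⌊ (t , h) ≟² p ⌋ then 0 else f t h

punch-elsewhere : ∀ p f {t h} → (t , h) ≢ p → punch p f t h ≡ f t h
punch-elsewhere p f {t} {h} ≢p rewrite ⌊⌋-false ((t , h) ≟² p) ≢p = refl

Σ²-punch : ∀ {N₁ N₂ t₀ h₀} f → t₀ < N₁ → h₀ < N₂ → Σ² N₁ N₂ f ≡ f t₀ h₀ + Σ² N₁ N₂ (punch (t₀ , h₀) f)
Σ²-punch {N₁} {N₂} {t₀} {h₀} f t₀<N₁ h₀<N₂ =
  Σ<-excess N₁ t₀ (f t₀ h₀) t₀<N₁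
    (λ t _ t≢t₀ → Σ<-cong N₂ (λ h _ → sym (punch-elsewhere _ f (t≢t₀ ∘′ cong proj₁))))
    (Σ<-excess N₂ h₀ (f t₀ h₀) h₀<N₂
       (λ h _ h≢h₀ → sym (punch-elsewhere _ f (h≢h₀ ∘′ cong proj₂)))
       (sym (trans (cong (f t₀ h₀ +_) punched) (+-identityʳ (f t₀ h₀)))))
  where
  punched : punch (t₀ , h₀) f t₀ h₀ ≡ 0
  punched rewrite ⌊⌋-true ((t₀ , h₀) ≟² (t₀ , h₀)) refl = refl

InGrid : ℕ → ℕ → (ℕ → ℕ → ℕ) → ℕ × ℕ → Set
InGrid N₁ N₂ f (t , h) = t < N₁ × h < N₂ × 1 ≤ f t h

length≤Σ² : ∀ {N₁ N₂ f} ps → Unique ps → All (InGrid N₁ N₂ f) ps → length ps ≤ Σ² N₁ N₂ f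
length≤Σ²             []              []          []                         = z≤n
length≤Σ² {N₁} {N₂} {f} ((t₀ , h₀) ∷ ps) (p∉ps ∷ ps!) ((t₀<N₁ , h₀<N₂ , pos) ∷ inside) =
  subst (suc (length ps) ≤_) (sym (Σ²-punch f t₀<N₁ h₀<N₂))
        (+-mono-≤ pos (length≤Σ² ps ps! (All.zipWith still-inside (p∉ps , inside))))
  where
  still-inside : ∀ {p} → (t₀ , h₀) ≢ p × InGrid N₁ N₂ f p → InGrid N₁ N₂ (punch (t₀ , h₀) f) p
  still-inside {t , h} (≢p , t<N₁ , h<N₂ , pos′) =
    t<N₁ , h<N₂ , subst (1 ≤_) (sym (punch-elsewhere _ f (≢p ∘′ sym))) pos′

module _ {n : ℕ} where

  Over : Fin n → Fin n → List (Fin n) → Set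
  Over u v = All (λ a → a ≡ u ⊎ a ≡ v)

  pair? : (u v : Fin n) → Decidable (λ a → a ≡ u ⊎ a ≡ v)
  pair? u v a = (a ≟ u) ⊎-dec (a ≟ v)

  restrict-accept : ∀ {u v a : Fin n} l → a ≡ u ⊎ a ≡ v → restrict u v (a ∷ l) ≡ a ∷ restrict u v l
  restrict-accept {u} {v} l = filter-accept (pair? u v)

  restrict-reject : ∀ {u v a : Fin n} l → a ≢ u → a ≢ v → restrict u v (a ∷ l) ≡ restrict u v l
  restrict-reject {u} {v} l a≢u a≢v = filter-reject (pair? u v) [ a≢u , a≢v ]

  restrict-++ : ∀ (u v : Fin n) l₁ l₂ → restrict u v (l₁ ++ l₂) ≡ restrict u v l₁ ++ restrict u v l₂
  restrict-++ u v = filter-++ (pair? u v)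

  restrict-over : ∀ {u v : Fin n} {l} → Over u v l → restrict u v l ≡ l
  restrict-over {u} {v} = filter-all (pair? u v)

  restrict-replicate-outside : ∀ {u v a : Fin n} k → a ≢ u → a ≢ v → restrict u v (replicate k a) ≡ []
  restrict-replicate-outside {u} {v} k a≢u a≢v = filter-none (pair? u v) (replicate⁺ k [ a≢u , a≢v ])

  first : Fin n → Fin n → List (Fin n) → Maybe (Fin n)
  first u v l = head (restrict u v l)

  first-comm : ∀ (u v : Fin n) l → first u v l ≡ first v u l
  first-comm u v l = cong head (filter-≐ (pair? u v) (pair? v u) (⊎-swap , ⊎-swap) l)

  first-head : ∀ {u v a : Fin n} l → a ≡ u ⊎ a ≡ v → first u v (a ∷ l) ≡ just a
  first-head l a∈uv = cong head (restrict-accept l a∈uv)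

  first-skip : ∀ {u v a : Fin n} l → a ≢ u → a ≢ v → first u v (a ∷ l) ≡ first u v l
  first-skip l a≢u a≢v = cong head (restrict-reject l a≢u a≢v)

  pair-or-not : ∀ (a u v : Fin n) → (a ≡ u ⊎ a ≡ v) ⊎ (a ≢ u × a ≢ v)
  pair-or-not a u v with a ≟ u | a ≟ v
  ... | yes a≡u | _       = inj₁ (inj₁ a≡u)
  ... | no _    | yes a≡v = inj₁ (inj₂ a≡v)
  ... | no a≢u  | no a≢v  = inj₂ (a≢u , a≢v)

  first-∈ : ∀ {u : Fin n} v {l} → u ∈ l → first u v l ≡ just u ⊎ first u v l ≡ just v
  first-∈ {u} v {a ∷ l} u∈l with pair-or-not a u v | u∈l
  ... | inj₁ (inj₁ refl)  | _          = inj₁ (first-head l (inj₁ refl))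
  ... | inj₁ (inj₂ refl)  | _          = inj₂ (first-head l (inj₂ refl))
  ... | inj₂ (a≢u , _)    | here u≡a   = ⊥-elim (a≢u (sym u≡a))
  ... | inj₂ (a≢u , a≢v)  | there u∈l′ rewrite first-skip l a≢u a≢v = first-∈ v u∈l′

  first-trans : ∀ {u v w : Fin n} l → u ≢ w → v ≢ w →
                first v w l ≡ just v → first u w l ≡ just w → first u v l ≡ just v
  first-trans {u} {v} {w} (a ∷ l) u≢w v≢w vw uw with pair-or-not a u v
  ... | inj₁ (inj₁ refl) = ⊥-elim (u≢w (just-injective (trans (sym (first-head l (inj₁ refl))) uw)))
  ... | inj₁ (inj₂ refl) = first-head l (inj₂ refl)
  ... | inj₂ (a≢u , a≢v) with pair-or-not a v w
  ...   | inj₁ (inj₁ a≡v)  = ⊥-elim (a≢v a≡v)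
  ...   | inj₁ (inj₂ refl) = ⊥-elim (v≢w (sym (just-injective (trans (sym (first-head l (inj₂ refl))) vw))))
  ...   | inj₂ (_ , a≢w)   rewrite first-skip {u} {v} l a≢u a≢v =
    first-trans l u≢w v≢w (trans (sym (first-skip l a≢v a≢w)) vw) (trans (sym (first-skip l a≢u a≢w)) uw)

  count-++ : ∀ (u : Fin n) l₁ l₂ → count u (l₁ ++ l₂) ≡ count u l₁ + count u l₂
  count-++ u []       l₂ = refl
  count-++ u (a ∷ l₁) l₂ with a ≟ u
  ... | yes _ = cong suc (count-++ u l₁ l₂)
  ... | no _  = count-++ u l₁ l₂

  count-self : ∀ (u : Fin n) l → count u (u ∷ l) ≡ suc (count u l)
  count-self u l with u ≟ u
  ... | yes _   = refl
  ... | no u≢u = ⊥-elim (u≢u refl)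

  count-≢ : ∀ {u a : Fin n} l → a ≢ u → count u (a ∷ l) ≡ count u l
  count-≢ {u} {a} l a≢u with a ≟ u
  ... | yes a≡u = ⊥-elim (a≢u a≡u)
  ... | no _    = refl

  count-replicate-≡ : ∀ (u : Fin n) k → count u (replicate k u) ≡ k
  count-replicate-≡ u zero    = refl
  count-replicate-≡ u (suc k) = trans (count-self u (replicate k u)) (cong suc (count-replicate-≡ u k))

  count-replicate-≢ : ∀ {u a : Fin n} k → a ≢ u → count u (replicate k a) ≡ 0
  count-replicate-≢ zero    a≢u = refl
  count-replicate-≢ {u} (suc k) a≢u = trans (count-≢ {u} (replicate k _) a≢u) (count-replicate-≢ k a≢u)

  length-over : ∀ {u v : Fin n} → u ≢ v → ∀ l → Over u v l → length l ≡ count u l + count v l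
  length-over u≢v []      []              = refl
  length-over {u} {v} u≢v (a ∷ l) (inj₁ refl ∷ p) =
    trans (cong suc (length-over u≢v l p)) (sym (cong₂ _+_ (count-self u l) (count-≢ {v} l u≢v)))
  length-over {u} {v} u≢v (a ∷ l) (inj₂ refl ∷ p) =
    trans (cong suc (length-over u≢v l p))
          (trans (sym (+-suc _ _)) (sym (cong₂ _+_ (count-≢ {u} l (u≢v ∘′ sym)) (count-self v l))))

  restrict-over-third : ∀ {u v w : Fin n} → v ≢ u → v ≢ w → ∀ l → Over u v l →
                        restrict u w l ≡ replicate (count u l) u
  restrict-over-third v≢u v≢w []      []              = refl
  restrict-over-third v≢u v≢w (a ∷ l) (inj₁ refl ∷ p) =
    trans (restrict-accept l (inj₁ refl))
          (trans (cong (a ∷_) (restrict-over-third v≢u v≢w l p)) (cong (λ k → replicate k a) (sym (count-self a l))))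
  restrict-over-third {u} v≢u v≢w (a ∷ l) (inj₂ refl ∷ p) =
    trans (restrict-reject l v≢u v≢w)
          (trans (restrict-over-third v≢u v≢w l p) (cong (λ k → replicate k _) (sym (count-≢ {u} l v≢u))))

  swap-over : ∀ {u v : Fin n} {l} → Over u v l → Over v u l
  swap-over = All.map ⊎-swap

  restrict-burst-outside : ∀ {u v w : Fin n} → w ≢ u → w ≢ v → ∀ {Q₁ Q₂} k → Over u v Q₁ → Over u v Q₂ →
                           restrict u v (Q₁ ++ replicate k w ++ Q₂) ≡ Q₁ ++ Q₂
  restrict-burst-outside {u} {v} {w} w≢u w≢v {Q₁} {Q₂} k o₁ o₂ = begin
    restrict u v (Q₁ ++ replicate k w ++ Q₂)
      ≡⟨ restrict-++ u v Q₁ _ ⟩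
    restrict u v Q₁ ++ restrict u v (replicate k w ++ Q₂)
      ≡⟨ cong (restrict u v Q₁ ++_) (restrict-++ u v (replicate k w) Q₂) ⟩
    restrict u v Q₁ ++ restrict u v (replicate k w) ++ restrict u v Q₂
      ≡⟨ cong₂ (λ l₁ l₂ → l₁ ++ l₂ ++ restrict u v Q₂) (restrict-over o₁) (restrict-replicate-outside k w≢u w≢v) ⟩
    Q₁ ++ restrict u v Q₂
      ≡⟨ cong (Q₁ ++_) (restrict-over o₂) ⟩
    Q₁ ++ Q₂ ∎
    where open ≡-Reasoning

  restrict-burst-inside : ∀ {u v w : Fin n} → v ≢ u → v ≢ w → ∀ {Q₁ Q₂} k → Over u v Q₁ → Over u v Q₂ →
    restrict u w (Q₁ ++ replicate k w ++ Q₂) ≡ replicate (count u Q₁) u ++ replicate k w ++ replicate (count u Q₂) u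
  restrict-burst-inside {u} {v} {w} v≢u v≢w {Q₁} {Q₂} k o₁ o₂ = begin
    restrict u w (Q₁ ++ replicate k w ++ Q₂)
      ≡⟨ restrict-++ u w Q₁ _ ⟩
    restrict u w Q₁ ++ restrict u w (replicate k w ++ Q₂)
      ≡⟨ cong (restrict u w Q₁ ++_) (restrict-++ u w (replicate k w) Q₂) ⟩
    restrict u w Q₁ ++ restrict u w (replicate k w) ++ restrict u w Q₂
      ≡⟨ cong₂ (λ l₁ l₂ → l₁ ++ l₂ ++ restrict u w Q₂)
               (restrict-over-third v≢u v≢w Q₁ o₁) (restrict-over (replicate⁺ k (inj₂ refl))) ⟩
    replicate (count u Q₁) u ++ replicate k w ++ restrict u w Q₂
      ≡⟨ cong (λ l → replicate (count u Q₁) u ++ replicate k w ++ l) (restrict-over-third v≢u v≢w Q₂ o₂) ⟩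
    replicate (count u Q₁) u ++ replicate k w ++ replicate (count u Q₂) u ∎
    where open ≡-Reasoning

  swapDist-pos : ∀ {s t : List (Fin n)} → s ≢ t → 1 ≤ swapDist s t
  swapDist-pos {s} {t} s≢t rewrite ⌊⌋-false (≡-dec _≟_ s t) s≢t = s≤s z≤n

  pos₀-pos : ∀ {z a : Fin n} r → a ≢ z → 1 ≤ pos₀ z (a ∷ r)
  pos₀-pos {z} {a} r a≢z rewrite ⌊⌋-false (a ≟ z) a≢z = s≤s z≤n

module _ {n : ℕ} (A : Algorithm n) where

  ∈-state : ∀ u σ → u ∈ S A σ
  ∈-state u σ = ∈-resp-↭ (↭-sym (linear A σ)) (∈-allFin u)

  first-projective : Projective A → ∀ u v σ → first u v (S A σ) ≡ first u v (S A (restrict u v σ))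
  first-projective proj u v σ = cong head (proj u v σ)

  serveCost-pos : ∀ {x y z v σ} → z ≡ x ⊎ z ≡ y → v ≢ z → first x y (S A σ) ≡ just v → 1 ≤ serveCost A σ z
  serveCost-pos {x} {y} {z} {v} {σ} z∈xy v≢z v-first with toSum (≡-dec _≟_ (S A σ) (S A (σ ∷ʳ z)))
  ... | inj₂ moved = ≤-trans (swapDist-pos moved) (m≤m+n _ _)
  ... | inj₁ same = ≤-trans (not-in-front (S A (σ ∷ʳ z)) (trans (cong (first x y) (sym same)) v-first)) (m≤n+m _ _)
    where
    not-in-front : ∀ l → first x y l ≡ just v → 1 ≤ pos₀ z l
    not-in-front (a ∷ r) a-first =
      pos₀-pos r λ { refl → v≢z (just-injective (trans (sym a-first) (first-head r z∈xy))) }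

  costAt-serveCost : ∀ {x y} Q z r {i j} → EndsAt x y Q i j → length Q ≡ i + j →
                     costAt A x y (Q ++ z ∷ r) i j ≡ serveCost A Q z
  costAt-serveCost {x} {y} Q z r {i} {j} (cx , cy) len
    with drop (i + j) (Q ++ z ∷ r) | subst (λ k → drop k (Q ++ z ∷ r) ≡ z ∷ r) len (drop-length-++ Q (z ∷ r))
  ... | .(z ∷ r) | refl
    rewrite sym len | take-length-++ Q (z ∷ r) | cx | cy | ⌊⌋-true (i ℕ≟ i) refl | ⌊⌋-true (j ℕ≟ j) refl = refl

module Burst {n : ℕ} (A : Algorithm n) (M : ℕ) where

  StillAhead : Fin n → Fin n → ℕ → ℕ → Set
  StillAhead u w a d = first u w (S A (replicate a u ++ replicate M w ++ replicate d u)) ≡ just w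

  ahead-after-burst : Regular M A → ∀ {u w} a → u ≢ w → StillAhead u w a 0
  ahead-after-burst reg {u} {w} a u≢w with reg w (replicate a u)
  ... | r , w-front = trans (cong (λ l → first u w (S A (replicate a u ++ l))) (++-identityʳ (replicate M w)))
                            (trans (cong (first u w) w-front) (first-head r (inj₂ refl)))

  overtaken-after-burst : Regular M A → ∀ {u w} a {d} → u ≢ w → M ≤ d → ¬ StillAhead u w a d
  overtaken-after-burst reg {u} {w} a {d} u≢w M≤d ahead
    with reg u (replicate a u ++ replicate M w ++ replicate (d ∸ M) u)
  ... | r , u-front = u≢w (just-injective (trans (sym u-first) ahead))
    where
    open ≡-Reasoning
    u-first : first u w (S A (replicate a u ++ replicate M w ++ replicate d u)) ≡ just u
    u-first = begin
      first u w (S A (replicate a u ++ replicate M w ++ replicate d u))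
        ≡⟨ cong (λ k → first u w (S A (replicate a u ++ replicate M w ++ replicate k u))) (sym (m∸n+n≡m M≤d)) ⟩
      first u w (S A (replicate a u ++ replicate M w ++ replicate (d ∸ M + M) u))
        ≡⟨ cong (λ l → first u w (S A l)) (reassoc (replicate a u) (replicate M w) (d ∸ M)) ⟩
      first u w (S A ((replicate a u ++ replicate M w ++ replicate (d ∸ M) u) ++ replicate M u))
        ≡⟨ cong (first u w) u-front ⟩
      first u w (u ∷ r)
        ≡⟨ first-head r (inj₁ refl) ⟩
      just u ∎
      where
      reassoc : ∀ l₁ l₂ k → l₁ ++ l₂ ++ replicate (k + M) u ≡ (l₁ ++ l₂ ++ replicate k u) ++ replicate M u
      reassoc l₁ l₂ k rewrite replicate-+ k M u | ++-assoc l₁ (l₂ ++ replicate k u) (replicate M u)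
                            | ++-assoc l₂ (replicate k u) (replicate M u) = refl

  StillAhead? : ∀ u w a d → Dec (StillAhead u w a d)
  StillAhead? u w a d = Maybe.≡-dec _≟_ _ _

  Threshold : Fin n → Fin n → ℕ → ℕ → Set
  Threshold u w c p = (∀ d → d ≤ p → StillAhead u w (c ∸ d) d) × ¬ StillAhead u w (c ∸ suc p) (suc p)

  threshold : Regular M A → ∀ {u w} c → u ≢ w → ∃[ p ] p < M × Threshold u w c p
  threshold reg {u} {w} c u≢w =
    first-failure (λ d → StillAhead? u w (c ∸ d) d) (ahead-after-burst reg c u≢w)
                  M (overtaken-after-burst reg (c ∸ M) u≢w ≤-refl)

  precedes-via-burst : Projective A → ∀ {u v w} → v ≢ u → u ≢ w → v ≢ w → ∀ {Q₁ Q₂} → Over u v Q₁ → Over u v Q₂ →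
                       StillAhead u w (count u Q₁) (count u Q₂) → ¬ StillAhead v w (count v Q₁) (count v Q₂) →
                       first u v (S A (Q₁ ++ Q₂)) ≡ just v
  precedes-via-burst proj {u} {v} {w} v≢u u≢w v≢w {Q₁} {Q₂} o₁ o₂ u-behind ¬v-behind = begin
    first u v (S A (Q₁ ++ Q₂))
      ≡⟨ cong (λ σ → first u v (S A σ)) (sym (restrict-burst-outside (u≢w ∘′ sym) (v≢w ∘′ sym) M o₁ o₂)) ⟩
    first u v (S A (restrict u v τ))
      ≡⟨ sym (first-projective A proj u v τ) ⟩
    first u v (S A τ)
      ≡⟨ first-trans (S A τ) u≢w v≢w v-before-w w-before-u ⟩
    just v ∎
    where
    open ≡-Reasoning
    τ = Q₁ ++ replicate M w ++ Q₂

    w-before-u : first u w (S A τ) ≡ just w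
    w-before-u = trans (first-projective A proj u w τ)
                       (trans (cong (λ σ → first u w (S A σ)) (restrict-burst-inside v≢u v≢w M o₁ o₂)) u-behind)

    v-before-w : first v w (S A τ) ≡ just v
    v-before-w with first-∈ w (∈-state A v τ)
    ... | inj₁ v-first = v-first
    ... | inj₂ w-first = ⊥-elim (¬v-behind (trans
            (cong (λ σ → first v w (S A σ))
                  (sym (restrict-burst-inside (v≢u ∘′ sym) u≢w M (swap-over o₁) (swap-over o₂))))
            (trans (sym (first-projective A proj v w τ)) w-first)))

  precedes-by-thresholds : Projective A → ∀ {u v w a b p q} → u ≢ v → u ≢ w → v ≢ w →
           Threshold u w a p → Threshold v w b q →
           ∀ Q₁ Q₂ → Over u v (Q₁ ++ Q₂) → count u (Q₁ ++ Q₂) ≡ a → count v (Q₁ ++ Q₂) ≡ b →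
           count u Q₂ ≤ p → count v Q₂ ≡ suc q → first u v (S A (Q₁ ++ Q₂)) ≡ just v
  precedes-by-thresholds proj {u} {v} {w} {b = b} u≢v u≢w v≢w (u-below , _) (_ , v-overtaken)
                         Q₁ Q₂ o cu cv cu₂≤p cv₂ =
    precedes-via-burst proj (u≢v ∘′ sym) u≢w v≢w (++⁻ˡ Q₁ o) (++⁻ʳ Q₁ o)
      (subst (λ c → StillAhead u w c (count u Q₂)) (sym (count-prefix u cu)) (u-below _ cu₂≤p))
      (λ v-behind → v-overtaken (subst₂ (StillAhead v w) (trans (count-prefix v cv) (cong (b ∸_) cv₂)) cv₂ v-behind))
    where
    count-prefix : ∀ z {c} → count z (Q₁ ++ Q₂) ≡ c → count z Q₁ ≡ c ∸ count z Q₂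
    count-prefix z cz =
      trans (sym (m+n∸n≡m _ (count z Q₂))) (cong (_∸ count z Q₂) (trans (sym (count-++ z Q₁ Q₂)) cz))

data Letter : Set where
  X Y : Letter

other : Letter → Letter
other X = Y
other Y = X

-- many ℓ stands for M̂ - 3 requests to ℓ, so that run ℓ is ℓ^M̂.
data Atom : Set where
  one many : Letter → Atom

_==_ : Letter → Letter → Bool
X == X = true
Y == Y = true
_ == _ = false

letter : Atom → Letter
letter (one ℓ)  = ℓ
letter (many ℓ) = ℓ

run : Letter → List Atom
run ℓ = one ℓ ∷ one ℓ ∷ one ℓ ∷ many ℓ ∷ []

φ-atoms : List Atom
φ-atoms = run X ++ one Y ∷ run X ++ run Y ++ one X ∷ run Y ++ run X ++ one Y ∷ one X ∷ one Y ∷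
          run X ++ run Y ++ one X ∷ one Y ∷ one X ∷ run Y

ones manys : List Atom → ℕ
ones  []           = 0
ones  (one _ ∷ w)  = suc (ones w)
ones  (many _ ∷ w) = ones w
manys []           = 0
manys (one _ ∷ w)  = manys w
manys (many _ ∷ w) = suc (manys w)

32+8e≡2H : ∀ e → 32 + 8 * e ≡ 2 * (4 * (3 + e) + 4)
32+8e≡2H = solve-∀

module Word {n : ℕ} (x y : Fin n) (e : ℕ) where

  item : Letter → Fin n
  item X = x
  item Y = y

  size : Atom → ℕ
  size (one _)  = 1
  size (many _) = e

  ⟦_⟧ₐ : Atom → List (Fin n)
  ⟦ a ⟧ₐ = replicate (size a) (item (letter a))

  -- The singleton clause makes ⟦ φ-atoms ⟧ reduce to phi x y (3 + e).
  ⟦_⟧ : List Atom → List (Fin n)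
  ⟦ [] ⟧        = []
  ⟦ a ∷ [] ⟧    = ⟦ a ⟧ₐ
  ⟦ a ∷ b ∷ w ⟧ = ⟦ a ⟧ₐ ++ ⟦ b ∷ w ⟧

  ⟦∷⟧ : ∀ a w → ⟦ a ∷ w ⟧ ≡ ⟦ a ⟧ₐ ++ ⟦ w ⟧
  ⟦∷⟧ a []      = sym (++-identityʳ ⟦ a ⟧ₐ)
  ⟦∷⟧ a (b ∷ w) = refl

  ⟦++⟧ : ∀ u v → ⟦ u ++ v ⟧ ≡ ⟦ u ⟧ ++ ⟦ v ⟧
  ⟦++⟧ []      v = refl
  ⟦++⟧ (a ∷ u) v = begin
    ⟦ a ∷ u ++ v ⟧             ≡⟨ ⟦∷⟧ a (u ++ v) ⟩
    ⟦ a ⟧ₐ ++ ⟦ u ++ v ⟧       ≡⟨ cong (⟦ a ⟧ₐ ++_) (⟦++⟧ u v) ⟩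
    ⟦ a ⟧ₐ ++ ⟦ u ⟧ ++ ⟦ v ⟧   ≡⟨ ++-assoc ⟦ a ⟧ₐ ⟦ u ⟧ ⟦ v ⟧ ⟨
    (⟦ a ⟧ₐ ++ ⟦ u ⟧) ++ ⟦ v ⟧ ≡⟨ cong (_++ ⟦ v ⟧) (⟦∷⟧ a u) ⟨
    ⟦ a ∷ u ⟧ ++ ⟦ v ⟧         ∎
    where open ≡-Reasoning

  length-⟦∷⟧ : ∀ a w → length ⟦ a ∷ w ⟧ ≡ size a + length ⟦ w ⟧
  length-⟦∷⟧ a w =
    trans (cong length (⟦∷⟧ a w)) (trans (length-++ ⟦ a ⟧ₐ) (cong (_+ length ⟦ w ⟧) (length-replicate (size a))))

  length-⟦⟧ : ∀ w → length ⟦ w ⟧ ≡ ones w + manys w * e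
  length-⟦⟧ []           = refl
  length-⟦⟧ (one ℓ ∷ w)  = trans (length-⟦∷⟧ (one ℓ) w) (cong suc (length-⟦⟧ w))
  length-⟦⟧ (many ℓ ∷ w) = trans (length-⟦∷⟧ (many ℓ) w)
                                 (trans (cong (e +_) (length-⟦⟧ w)) (x∙yz≈y∙xz +-commutativeSemigroup e (ones w) _))

  length-phi : length (phi x y (3 + e)) ≡ 2 * H (3 + e)
  length-phi = trans (length-⟦⟧ φ-atoms) (32+8e≡2H e)

  item-∈ : ∀ ℓ → item ℓ ≡ x ⊎ item ℓ ≡ y
  item-∈ X = inj₁ refl
  item-∈ Y = inj₂ refl

  item-other : x ≢ y → ∀ ℓ → item (other ℓ) ≢ item ℓ
  item-other x≢y X = x≢y ∘′ sym
  item-other x≢y Y = x≢y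

  over-⟦⟧ : ∀ w → Over x y ⟦ w ⟧
  over-⟦⟧ []      = []
  over-⟦⟧ (a ∷ w) = subst (Over x y) (sym (⟦∷⟧ a w)) (++⁺ (replicate⁺ (size a) (item-∈ (letter a))) (over-⟦⟧ w))

  # : Letter → List Atom → ℕ
  # ℓ []      = 0
  # ℓ (a ∷ w) = (if ℓ == letter a then size a else 0) + # ℓ w

  count-item : x ≢ y → ∀ ℓ ℓ′ k → count (item ℓ) (replicate k (item ℓ′)) ≡ (if ℓ == ℓ′ then k else 0)
  count-item x≢y X X k = count-replicate-≡ x k
  count-item x≢y X Y k = count-replicate-≢ k (x≢y ∘′ sym)
  count-item x≢y Y X k = count-replicate-≢ k x≢y
  count-item x≢y Y Y k = count-replicate-≡ y k

  count-⟦⟧ : x ≢ y → ∀ ℓ w → count (item ℓ) ⟦ w ⟧ ≡ # ℓ w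
  count-⟦⟧ x≢y ℓ []      = refl
  count-⟦⟧ x≢y ℓ (a ∷ w) = begin
    count (item ℓ) ⟦ a ∷ w ⟧                           ≡⟨ cong (count (item ℓ)) (⟦∷⟧ a w) ⟩
    count (item ℓ) (⟦ a ⟧ₐ ++ ⟦ w ⟧)                   ≡⟨ count-++ (item ℓ) ⟦ a ⟧ₐ ⟦ w ⟧ ⟩
    count (item ℓ) ⟦ a ⟧ₐ + count (item ℓ) ⟦ w ⟧
      ≡⟨ cong₂ _+_ (count-item x≢y ℓ (letter a) (size a)) (count-⟦⟧ x≢y ℓ w) ⟩
    (if ℓ == letter a then size a else 0) + # ℓ w      ∎
    where open ≡-Reasoning

  ⟦⟧-split : ∀ w k {ℓ r} → drop k w ≡ one ℓ ∷ r → ⟦ w ⟧ ≡ ⟦ take k w ⟧ ++ item ℓ ∷ ⟦ r ⟧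
  ⟦⟧-split w k {ℓ} {r} at = begin
    ⟦ w ⟧                          ≡⟨ cong ⟦_⟧ (take++drop≡id k w) ⟨
    ⟦ take k w ++ drop k w ⟧       ≡⟨ ⟦++⟧ (take k w) (drop k w) ⟩
    ⟦ take k w ⟧ ++ ⟦ drop k w ⟧   ≡⟨ cong (λ v → ⟦ take k w ⟧ ++ ⟦ v ⟧) at ⟩
    ⟦ take k w ⟧ ++ ⟦ one ℓ ∷ r ⟧  ≡⟨ cong (⟦ take k w ⟧ ++_) (⟦∷⟧ (one ℓ) r) ⟩
    ⟦ take k w ⟧ ++ item ℓ ∷ ⟦ r ⟧ ∎
    where open ≡-Reasoning

  length-⟦take⟧-< : ∀ w {k₁ k₂ ℓ r} → k₁ < k₂ → drop k₁ w ≡ one ℓ ∷ r → length ⟦ take k₁ w ⟧ < length ⟦ take k₂ w ⟧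
  length-⟦take⟧-< (b ∷ w) {zero}   {suc k₂} {ℓ} _ refl =
    subst (0 <_) (sym (length-⟦∷⟧ (one ℓ) (take k₂ w))) (s≤s z≤n)
  length-⟦take⟧-< (b ∷ w) {suc k₁} {suc k₂} (s≤s k₁<k₂) at =
    subst₂ _<_ (sym (length-⟦∷⟧ b (take k₁ w))) (sym (length-⟦∷⟧ b (take k₂ w)))
           (+-monoʳ-< (size b) (length-⟦take⟧-< w k₁<k₂ at))

module _ {n : ℕ} (x y : Fin n) (Mh : ℕ) where

  phiPow-+ : ∀ k r → phiPow x y Mh (k + r) ≡ phiPow x y Mh k ++ phiPow x y Mh r
  phiPow-+ k r = trans (cong concat (replicate-+ k r (phi x y Mh))) (sym (concat-++ (replicate k _) (replicate r _)))

  length-phiPow : ∀ k → length (phiPow x y Mh k) ≡ k * length (phi x y Mh)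
  length-phiPow zero    = refl
  length-phiPow (suc k) = trans (length-++ (phi x y Mh)) (cong (length (phi x y Mh) +_) (length-phiPow k))

  over-preamble : ∀ t h → Over x y (preamble x y Mh t h)
  over-preamble t h = ++⁺ (replicate⁺ (Mh + t) (inj₁ refl)) (replicate⁺ (Mh + h) (inj₂ refl))

  over-phiPow : Over x y (phi x y Mh) → ∀ k → Over x y (phiPow x y Mh k)
  over-phiPow over-phi k = concat⁺ (replicate⁺ k over-phi)

  lam-split : ∀ {K t h k W z R} → phi x y Mh ≡ W ++ z ∷ R → k < K →
              lam x y Mh K t h ≡ (preamble x y Mh t h ++ phiPow x y Mh k ++ W) ++ z ∷ (R ++ phiPow x y Mh (K ∸ suc k))
  lam-split {K} {t} {h} {k} {W} {z} {R} split k<K = begin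
    pre ++ phiPow x y Mh K                          ≡⟨ cong (λ K′ → pre ++ phiPow x y Mh K′) K≡k+1+r ⟩
    pre ++ phiPow x y Mh (k + suc r)                ≡⟨ cong (pre ++_) (phiPow-+ k (suc r)) ⟩
    pre ++ pow ++ phi x y Mh ++ rest                ≡⟨ cong (λ φ′ → pre ++ pow ++ φ′ ++ rest) split ⟩
    pre ++ pow ++ (W ++ z ∷ R) ++ rest              ≡⟨ cong (λ l → pre ++ pow ++ l) (++-assoc W (z ∷ R) rest) ⟩
    pre ++ pow ++ W ++ z ∷ R ++ rest                ≡⟨ cong (pre ++_) (++-assoc pow W (z ∷ R ++ rest)) ⟨
    pre ++ (pow ++ W) ++ z ∷ R ++ rest              ≡⟨ ++-assoc pre (pow ++ W) (z ∷ R ++ rest) ⟨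
    (pre ++ pow ++ W) ++ z ∷ R ++ rest              ∎
    where
    open ≡-Reasoning
    pre  = preamble x y Mh t h
    pow  = phiPow x y Mh k
    r    = K ∸ suc k
    rest = phiPow x y Mh r
    K≡k+1+r : K ≡ k + suc r
    K≡k+1+r = trans (sym (m+[n∸m]≡n k<K)) (sym (+-suc k r))

module AlongPhi {n : ℕ} (A : Algorithm n) (proj : Projective A) (M : ℕ)
             {x y w : Fin n} (x≢y : x ≢ y) (x≢w : x ≢ w) (y≢w : y ≢ w) (e : ℕ) {i j p q : ℕ}
             (x-threshold : Burst.Threshold A M x w i p) (y-threshold : Burst.Threshold A M y w j q) where

  open Word x y e
  open Burst A M

  Mh : ℕ
  Mh = 3 + e

  bound : Letter → ℕ
  bound X = p
  bound Y = q

  leads-at-split : ∀ ℓ {Q} Q₁ Q₂ → count (item (other ℓ)) Q₂ ≤ bound (other ℓ) → count (item ℓ) Q₂ ≡ suc (bound ℓ) →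
          Q ≡ Q₁ ++ Q₂ → Over x y Q → EndsAt x y Q i j → first x y (S A Q) ≡ just (item ℓ)
  leads-at-split X Q₁ Q₂ y≤q x≡1+p refl o (cx , cy) =
    trans (first-comm x y (S A (Q₁ ++ Q₂)))
          (precedes-by-thresholds proj (x≢y ∘′ sym) y≢w x≢w y-threshold x-threshold
                                  Q₁ Q₂ (swap-over o) cy cx y≤q x≡1+p)
  leads-at-split Y Q₁ Q₂ x≤p y≡1+q refl o (cx , cy) =
    precedes-by-thresholds proj x≢y x≢w y≢w x-threshold y-threshold Q₁ Q₂ o cx cy x≤p y≡1+q

  Leads : List Atom → Letter → Set
  Leads sw ℓ = ∀ P {Q} → Q ≡ P ++ ⟦ sw ⟧ → Over x y Q → EndsAt x y Q i j → first x y (S A Q) ≡ just (item ℓ)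

  leads-suffix : ∀ ℓ {sw} R Q₂ → ⟦ sw ⟧ ≡ R ++ Q₂ →
                 count (item (other ℓ)) Q₂ ≤ bound (other ℓ) → count (item ℓ) Q₂ ≡ suc (bound ℓ) → Leads sw ℓ
  leads-suffix ℓ R Q₂ split c≤ c≡ P Q≡ =
    leads-at-split ℓ (P ++ R) Q₂ c≤ c≡ (trans Q≡ (trans (cong (P ++_) split) (sym (++-assoc P R Q₂))))

  count-block-other : ∀ ℓ k vw → count (item (other ℓ)) (replicate k (item ℓ) ++ ⟦ vw ⟧) ≡ # (other ℓ) vw
  count-block-other ℓ k vw =
    trans (count-++ _ (replicate k (item ℓ)) ⟦ vw ⟧)
          (cong₂ _+_ (count-replicate-≢ k (item-other x≢y ℓ ∘′ sym)) (count-⟦⟧ x≢y (other ℓ) vw))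

  count-block-same : ∀ ℓ k vw → count (item ℓ) (replicate k (item ℓ) ++ ⟦ vw ⟧) ≡ k + # ℓ vw
  count-block-same ℓ k vw =
    trans (count-++ _ (replicate k (item ℓ)) ⟦ vw ⟧)
          (cong₂ _+_ (count-replicate-≡ (item ℓ) k) (count-⟦⟧ x≢y ℓ vw))

  leads-at-one : ∀ ℓ aw vw → # (other ℓ) vw ≤ bound (other ℓ) → # ℓ vw ≡ bound ℓ → Leads (aw ++ one ℓ ∷ vw) ℓ
  leads-at-one ℓ aw vw o≤ ℓ≡ =
    leads-suffix ℓ {aw ++ one ℓ ∷ vw} ⟦ aw ⟧ (item ℓ ∷ ⟦ vw ⟧)
      (trans (⟦++⟧ aw (one ℓ ∷ vw)) (cong (⟦ aw ⟧ ++_) (⟦∷⟧ (one ℓ) vw)))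
      (subst (_≤ bound (other ℓ)) (sym (count-block-other ℓ 1 vw)) o≤)
      (trans (count-block-same ℓ 1 vw) (cong suc ℓ≡))

  leads-in-run : ∀ ℓ aw vw {d} → d < Mh → # (other ℓ) vw ≤ bound (other ℓ) → d + # ℓ vw ≡ bound ℓ →
                 Leads (aw ++ run ℓ ++ vw) ℓ
  leads-in-run ℓ aw vw {d} d<Mh o≤ ℓ≡ =
    leads-suffix ℓ {aw ++ run ℓ ++ vw} (⟦ aw ⟧ ++ replicate (Mh ∸ suc d) c) (replicate (suc d) c ++ ⟦ vw ⟧) split
      (subst (_≤ bound (other ℓ)) (sym (count-block-other ℓ (suc d) vw)) o≤)
      (trans (count-block-same ℓ (suc d) vw) (cong suc ℓ≡))
    where
    open ≡-Reasoning
    c = item ℓ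
    split : ⟦ aw ++ run ℓ ++ vw ⟧ ≡ (⟦ aw ⟧ ++ replicate (Mh ∸ suc d) c) ++ replicate (suc d) c ++ ⟦ vw ⟧
    split = begin
      ⟦ aw ++ run ℓ ++ vw ⟧
        ≡⟨ trans (⟦++⟧ aw (run ℓ ++ vw)) (cong (⟦ aw ⟧ ++_) (⟦++⟧ (run ℓ) vw)) ⟩
      ⟦ aw ⟧ ++ replicate Mh c ++ ⟦ vw ⟧
        ≡⟨ cong (λ k → ⟦ aw ⟧ ++ replicate k c ++ ⟦ vw ⟧) (sym (m∸n+n≡m d<Mh)) ⟩
      ⟦ aw ⟧ ++ replicate (Mh ∸ suc d + suc d) c ++ ⟦ vw ⟧
        ≡⟨ cong (λ l → ⟦ aw ⟧ ++ l ++ ⟦ vw ⟧) (replicate-+ (Mh ∸ suc d) (suc d) c) ⟩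
      ⟦ aw ⟧ ++ (replicate (Mh ∸ suc d) c ++ replicate (suc d) c) ++ ⟦ vw ⟧
        ≡⟨ cong (⟦ aw ⟧ ++_) (++-assoc (replicate (Mh ∸ suc d) c) _ _) ⟩
      ⟦ aw ⟧ ++ replicate (Mh ∸ suc d) c ++ replicate (suc d) c ++ ⟦ vw ⟧
        ≡⟨ ++-assoc ⟦ aw ⟧ _ _ ⟨
      (⟦ aw ⟧ ++ replicate (Mh ∸ suc d) c) ++ replicate (suc d) c ++ ⟦ vw ⟧ ∎

  -- Leads is taken from run Y on because every prefix preamble ++ φ^k ends in y^M̂.
  record Costly (k : ℕ) : Set where
    constructor costly
    field
      {ℓ}    : Letter
      {rest} : List Atom
      at     : drop k φ-atoms ≡ one ℓ ∷ rest
      behind : Leads (run Y ++ take k φ-atoms) (other ℓ)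

  offset : ℕ → ℕ
  offset k = length ⟦ take k φ-atoms ⟧

  EndsInRunY : List (Fin n) → Set
  EndsInRunY l = ∃[ P ] l ≡ P ++ ⟦ run Y ⟧

  preamble-ends : ∀ t h → EndsInRunY (preamble x y Mh t h)
  preamble-ends t h = replicate (Mh + t) x ++ replicate h y , (begin
    replicate (Mh + t) x ++ replicate (Mh + h) y
      ≡⟨ cong (λ k → replicate (Mh + t) x ++ replicate k y) (+-comm Mh h) ⟩
    replicate (Mh + t) x ++ replicate (h + Mh) y
      ≡⟨ cong (replicate (Mh + t) x ++_) (replicate-+ h Mh y) ⟩
    replicate (Mh + t) x ++ replicate h y ++ replicate Mh y
      ≡⟨ ++-assoc (replicate (Mh + t) x) _ _ ⟨
    (replicate (Mh + t) x ++ replicate h y) ++ replicate Mh y ∎)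
    where open ≡-Reasoning

  ++phiPow-ends : ∀ l k → EndsInRunY l → EndsInRunY (l ++ phiPow x y Mh k)
  ++phiPow-ends l zero    (P , l≡) = P , trans (++-identityʳ l) l≡
  ++phiPow-ends l (suc k) _        =
    map₂ (trans (sym (++-assoc l (phi x y Mh) (phiPow x y Mh k))))
         (++phiPow-ends (l ++ phi x y Mh) k (l ++ ⟦ take 36 φ-atoms ⟧ , phi-ends))
    where
    phi-ends : l ++ phi x y Mh ≡ (l ++ ⟦ take 36 φ-atoms ⟧) ++ ⟦ run Y ⟧
    phi-ends = trans (cong (l ++_) (⟦++⟧ (take 36 φ-atoms) (run Y))) (sym (++-assoc l _ _))

  L : ℕ
  L = length (phi x y Mh)

  -- The position of φ at which λ_{t,h} passes (i, j), if it does.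
  phase : ℕ → ℕ → ℕ
  phase t h = (i + j ∸ length (preamble x y Mh t h)) % L

  phase-of : ∀ {t h k W} → length (preamble x y Mh t h ++ phiPow x y Mh k ++ W) ≡ i + j → length W < L →
             phase t h ≡ length W
  phase-of {t} {h} {k} {W} len W<L = begin
    (i + j ∸ length pre) % L                          ≡⟨ cong (λ s → (s ∸ length pre) % L) (sym len) ⟩
    (length (pre ++ pow ++ W) ∸ length pre) % L       ≡⟨ cong (λ s → (s ∸ length pre) % L) (length-++ pre) ⟩
    (length pre + length (pow ++ W) ∸ length pre) % L ≡⟨ cong (_% L) (m+n∸m≡n (length pre) _) ⟩
    length (pow ++ W) % L                             ≡⟨ cong (_% L) (length-++ pow) ⟩
    (length pow + length W) % L                       ≡⟨ cong (λ s → (s + length W) % L) (length-phiPow x y Mh k) ⟩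
    (k * L + length W) % L                            ≡⟨ cong (_% L) (+-comm (k * L) (length W)) ⟩
    (length W + k * L) % L                            ≡⟨ [m+kn]%n≡m%n (length W) k L ⟩
    length W % L                                      ≡⟨ m<n⇒m%n≡m W<L ⟩
    length W                                          ∎
    where
    open ≡-Reasoning
    pre = preamble x y Mh t h
    pow = phiPow x y Mh k

  offset<L : ∀ {k} → Costly k → offset k < L
  offset<L {k} (costly at _) =
    subst (offset k <_) (sym (trans (cong length (⟦⟧-split φ-atoms k at)) (length-++ ⟦ take k φ-atoms ⟧)))
          (m<m+n (offset k) (s≤s z≤n))

  module _ (K T : ℕ) where

    gridCost : ℕ → ℕ → ℕ
    gridCost t h = costAt A x y (lam x y Mh K t h) i j

    costly-hit : ∀ {k} → Costly k → ∀ {t h} → Hit x y Mh K (offset k) t h i j →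
                 1 ≤ gridCost t h × phase t h ≡ offset k
    costly-hit {k} c@(costly {ℓ} {rest} at behind) {t} {h} (k′ , k′<K , ends′) =
      cost-pos , phase-of {t} {h} {k′} {W} len (offset<L c)
      where
      W   = ⟦ take k φ-atoms ⟧
      pre = preamble x y Mh t h
      pow = phiPow x y Mh k′
      Q   = pre ++ pow ++ W
      split : phi x y Mh ≡ W ++ item ℓ ∷ ⟦ rest ⟧
      split = ⟦⟧-split φ-atoms k at
      ends : EndsAt x y Q i j
      ends = subst (λ V → EndsAt x y (pre ++ pow ++ V) i j)
                   (trans (cong (take (length W)) split) (take-length-++ W _)) ends′
      over : Over x y Q
      over = ++⁺ (over-preamble x y Mh t h) (++⁺ (over-phiPow x y Mh (over-⟦⟧ φ-atoms) k′) (over-⟦⟧ (take k φ-atoms)))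
      len : length Q ≡ i + j
      len = trans (length-over x≢y Q over) (cong₂ _+_ (proj₁ ends) (proj₂ ends))
      leader : first x y (S A Q) ≡ just (item (other ℓ))
      leader with ++phiPow-ends pre k′ (preamble-ends t h)
      ... | P , pre-pow≡ = behind P Q≡ over ends
        where
        open ≡-Reasoning
        Q≡ : Q ≡ P ++ ⟦ run Y ++ take k φ-atoms ⟧
        Q≡ = begin
          pre ++ pow ++ W                  ≡⟨ ++-assoc pre pow W ⟨
          (pre ++ pow) ++ W                ≡⟨ cong (_++ W) pre-pow≡ ⟩
          (P ++ ⟦ run Y ⟧) ++ W            ≡⟨ ++-assoc P ⟦ run Y ⟧ W ⟩
          P ++ ⟦ run Y ⟧ ++ W              ≡⟨ cong (P ++_) (⟦++⟧ (run Y) (take k φ-atoms)) ⟨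
          P ++ ⟦ run Y ++ take k φ-atoms ⟧ ∎
      cost-pos : 1 ≤ gridCost t h
      cost-pos = subst (1 ≤_)
        (sym (trans (cong (λ λs → costAt A x y λs i j) (lam-split x y Mh split k′<K))
                    (costAt-serveCost A Q _ _ ends len)))
        (serveCost-pos A (item-∈ ℓ) (item-other x≢y ℓ) leader)

    costly-point : Good x y Mh K T i j → ∀ {k} → Costly k →
                   Σ (ℕ × ℕ) λ p → InGrid (H Mh * T) (H Mh) gridCost p × uncurry phase p ≡ offset k
    costly-point good {k} c with good (offset k) (subst (offset k <_) length-phi (offset<L c))
    ... | (t , h) , (t< , h< , hit) , _ = (t , h) , (t< , h< , proj₁ (costly-hit c hit)) , proj₂ (costly-hit c hit)

    count-costly : Good x y Mh K T i j → (cs : List (Σ ℕ Costly)) →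
                   {True (linked? (λ a b → proj₁ a <? proj₁ b) cs)} → length cs ≤ sumΛ A x y Mh K T i j
    count-costly good cs {increasing?} =
      subst (_≤ sumΛ A x y Mh K T i j) (length-map point cs) (length≤Σ² (map point cs) distinct (inside cs))
      where
      point : Σ ℕ Costly → ℕ × ℕ
      point (k , c) = proj₁ (costly-point good c)

      point-phase : ∀ kc → uncurry phase (point kc) ≡ offset (proj₁ kc)
      point-phase (k , c) = proj₂ (proj₂ (costly-point good c))

      separate : ∀ {a b} → proj₁ a < proj₁ b → point a ≢ point b
      separate {k₁ , c₁} {k₂ , c₂} k₁<k₂ eq =
        <⇒≢ (length-⟦take⟧-< φ-atoms k₁<k₂ (Costly.at c₁))
            (trans (sym (point-phase (k₁ , c₁))) (trans (cong (uncurry phase) eq) (point-phase (k₂ , c₂))))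

      distinct : Unique (map point cs)
      distinct = AllPairs.map⁺ (AllPairs.map (λ {a} {b} → separate {a} {b})
                                             (Linked⇒AllPairs <-trans (toWitness increasing?)))

      inside : ∀ cs → All (InGrid (H Mh * T) (H Mh) gridCost) (map point cs)
      inside []            = []
      inside ((k , c) ∷ cs) = proj₁ (proj₂ (costly-point good c)) ∷ inside cs

  module _ (p<Mh : p < Mh) (q<Mh : q < Mh) where

    -- Each window run Y ++ take k φ-atoms is, by computation, of the form aw ++ run ℓ ++ vw or
    -- aw ++ one ℓ ∷ vw with the decisive request inside the displayed run or atom.
    costly-0 : Costly 0
    costly-0 = costly refl (leads-in-run Y [] [] q<Mh z≤n (+-identityʳ q))

    costly-1 : 1 ≤ p → Costly 1
    costly-1 1≤p = costly refl (leads-in-run Y [] (take 1 φ-atoms) q<Mh 1≤p (+-identityʳ q))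

    costly-2 : 2 ≤ p → Costly 2
    costly-2 2≤p = costly refl (leads-in-run Y [] (take 2 φ-atoms) q<Mh 2≤p (+-identityʳ q))

    costly-4 : Costly 4
    costly-4 = costly refl (leads-in-run X (run Y) [] p<Mh z≤n (+-identityʳ p))

    costly-5 : q ≡ 0 → Costly 5
    costly-5 q≡0 = costly refl (leads-at-one Y (run Y ++ run X) [] z≤n (sym q≡0))

    costly-6 : q ≡ 0 → 1 ≤ p → Costly 6
    costly-6 q≡0 1≤p = costly refl (leads-at-one Y (run Y ++ run X) (one X ∷ []) 1≤p (sym q≡0))

    costly-9 : Costly 9
    costly-9 = costly refl (leads-in-run X (run Y ++ take 5 φ-atoms) [] p<Mh z≤n (+-identityʳ p))

    costly-10 : 1 ≤ q → Costly 10
    costly-10 1≤q = costly refl (leads-in-run X (run Y ++ take 5 φ-atoms) (one Y ∷ []) p<Mh 1≤q (+-identityʳ p))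

    costly-11 : 2 ≤ q → Costly 11
    costly-11 2≤q =
      costly refl (leads-in-run X (run Y ++ take 5 φ-atoms) (one Y ∷ one Y ∷ []) p<Mh 2≤q (+-identityʳ p))

    costly-13 : Costly 13
    costly-13 = costly refl (leads-in-run Y (run Y ++ take 9 φ-atoms) [] q<Mh z≤n (+-identityʳ q))

    costly-14 : p ≡ 0 → Costly 14
    costly-14 p≡0 = costly refl (leads-at-one X (run Y ++ take 13 φ-atoms) [] z≤n (sym p≡0))

    costly-15 : p ≡ 0 → 1 ≤ q → Costly 15
    costly-15 p≡0 1≤q = costly refl (leads-at-one X (run Y ++ take 13 φ-atoms) (one Y ∷ []) 1≤q (sym p≡0))

    costly-18 : Costly 18
    costly-18 = costly refl (leads-in-run Y (run Y ++ take 14 φ-atoms) [] q<Mh z≤n (+-identityʳ q))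

    costly-19 : 1 ≤ p → Costly 19
    costly-19 1≤p = costly refl (leads-in-run Y (run Y ++ take 14 φ-atoms) (one X ∷ []) q<Mh 1≤p (+-identityʳ q))

    costly-20 : 2 ≤ p → Costly 20
    costly-20 2≤p =
      costly refl (leads-in-run Y (run Y ++ take 14 φ-atoms) (one X ∷ one X ∷ []) q<Mh 2≤p (+-identityʳ q))

    costly-22 : Costly 22
    costly-22 = costly refl (leads-in-run X (run Y ++ take 18 φ-atoms) [] p<Mh z≤n (+-identityʳ p))

    costly-23 : q ≡ 0 → Costly 23
    costly-23 q≡0 = costly refl (leads-at-one Y (run Y ++ take 22 φ-atoms) [] z≤n (sym q≡0))

    costly-24 : p ≡ 0 → Costly 24
    costly-24 p≡0 = costly refl (leads-at-one X (run Y ++ take 23 φ-atoms) [] z≤n (sym p≡0))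

    costly-24′ : 1 ≤ p → 1 ≤ q → Costly 24
    costly-24′ 1≤p 1≤q = costly refl
      (leads-in-run X (run Y ++ take 18 φ-atoms) (one Y ∷ one X ∷ []) (≤-<-trans (m∸n≤m p 1) p<Mh) 1≤q (m∸n+n≡m 1≤p))

    costly-25 : q ≡ 0 → Costly 25
    costly-25 q≡0 = costly refl (leads-at-one Y (run Y ++ take 24 φ-atoms) [] z≤n (sym q≡0))

    costly-25′ : q ≡ 1 → 1 ≤ p → Costly 25
    costly-25′ q≡1 1≤p = costly refl (leads-at-one Y (run Y ++ take 22 φ-atoms) (one X ∷ one Y ∷ []) 1≤p (sym q≡1))

    costly-26 : q ≡ 0 → 1 ≤ p → Costly 26
    costly-26 q≡0 1≤p = costly refl (leads-at-one Y (run Y ++ take 24 φ-atoms) (one X ∷ []) 1≤p (sym q≡0))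

    costly-29 : Costly 29
    costly-29 = costly refl (leads-in-run X (run Y ++ take 25 φ-atoms) [] p<Mh z≤n (+-identityʳ p))

    costly-30 : 1 ≤ q → Costly 30
    costly-30 1≤q = costly refl (leads-in-run X (run Y ++ take 25 φ-atoms) (one Y ∷ []) p<Mh 1≤q (+-identityʳ p))

    costly-31 : 2 ≤ q → Costly 31
    costly-31 2≤q =
      costly refl (leads-in-run X (run Y ++ take 25 φ-atoms) (one Y ∷ one Y ∷ []) p<Mh 2≤q (+-identityʳ p))

    costly-33 : Costly 33
    costly-33 = costly refl (leads-in-run Y (run Y ++ take 29 φ-atoms) [] q<Mh z≤n (+-identityʳ q))

    costly-34 : p ≡ 0 → Costly 34
    costly-34 p≡0 = costly refl (leads-at-one X (run Y ++ take 33 φ-atoms) [] z≤n (sym p≡0))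

    costly-35 : q ≡ 0 → Costly 35
    costly-35 q≡0 = costly refl (leads-at-one Y (run Y ++ take 34 φ-atoms) [] z≤n (sym q≡0))

    costly-35′ : 1 ≤ p → 1 ≤ q → Costly 35
    costly-35′ 1≤p 1≤q = costly refl
      (leads-in-run Y (run Y ++ take 29 φ-atoms) (one X ∷ one Y ∷ []) (≤-<-trans (m∸n≤m q 1) q<Mh) 1≤p (m∸n+n≡m 1≤q))

    costly-36 : p ≡ 0 → Costly 36
    costly-36 p≡0 = costly refl (leads-at-one X (run Y ++ take 35 φ-atoms) [] z≤n (sym p≡0))

    costly-36′ : p ≡ 1 → 1 ≤ q → Costly 36
    costly-36′ p≡1 1≤q = costly refl (leads-at-one X (run Y ++ take 33 φ-atoms) (one Y ∷ one X ∷ []) 1≤q (sym p≡1))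

    costly-37 : p ≡ 0 → 1 ≤ q → Costly 37
    costly-37 p≡0 1≤q = costly refl (leads-at-one X (run Y ++ take 35 φ-atoms) (one Y ∷ []) 1≤q (sym p≡0))

    16≤sumΛ : ∀ {K T} → Good x y Mh K T i j → 16 ≤ sumΛ A x y Mh K T i j
    16≤sumΛ {K} {T} good with classify p | classify q
    ... | inj₁ p≡0 | inj₁ q≡0 = count-costly K T good
      ( (0 , costly-0)       ∷ (4 , costly-4)       ∷ (5 , costly-5 q≡0)   ∷ (9 , costly-9)
      ∷ (13 , costly-13)     ∷ (14 , costly-14 p≡0) ∷ (18 , costly-18)     ∷ (22 , costly-22)
      ∷ (23 , costly-23 q≡0) ∷ (24 , costly-24 p≡0) ∷ (25 , costly-25 q≡0) ∷ (29 , costly-29)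
      ∷ (33 , costly-33)     ∷ (34 , costly-34 p≡0) ∷ (35 , costly-35 q≡0) ∷ (36 , costly-36 p≡0)
      ∷ [])
    ... | inj₁ p≡0 | inj₂ q≥1 = count-costly K T good
      ( (0 , costly-0)           ∷ (4 , costly-4)           ∷ (9 , costly-9)           ∷ (10 , costly-10 1≤q)
      ∷ (13 , costly-13)         ∷ (14 , costly-14 p≡0)     ∷ (15 , costly-15 p≡0 1≤q) ∷ (18 , costly-18)
      ∷ (22 , costly-22)         ∷ (24 , costly-24 p≡0)     ∷ (29 , costly-29)         ∷ (30 , costly-30 1≤q)
      ∷ (33 , costly-33)         ∷ (34 , costly-34 p≡0)     ∷ (36 , costly-36 p≡0)     ∷ (37 , costly-37 p≡0 1≤q)
      ∷ [])
      where 1≤q = at-least-one q≥1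
    ... | inj₂ p≥1 | inj₁ q≡0 = count-costly K T good
      ( (0 , costly-0)           ∷ (1 , costly-1 1≤p)       ∷ (4 , costly-4)           ∷ (5 , costly-5 q≡0)
      ∷ (6 , costly-6 q≡0 1≤p)   ∷ (9 , costly-9)           ∷ (13 , costly-13)         ∷ (18 , costly-18)
      ∷ (19 , costly-19 1≤p)     ∷ (22 , costly-22)         ∷ (23 , costly-23 q≡0)     ∷ (25 , costly-25 q≡0)
      ∷ (26 , costly-26 q≡0 1≤p) ∷ (29 , costly-29)         ∷ (33 , costly-33)         ∷ (35 , costly-35 q≡0)
      ∷ [])
      where 1≤p = at-least-one p≥1
    ... | inj₂ (inj₁ p≡1) | inj₂ (inj₁ q≡1) = count-costly K T good
      ( (0 , costly-0)            ∷ (1 , costly-1 1≤p)        ∷ (4 , costly-4)            ∷ (9 , costly-9)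
      ∷ (10 , costly-10 1≤q)      ∷ (13 , costly-13)          ∷ (18 , costly-18)          ∷ (19 , costly-19 1≤p)
      ∷ (22 , costly-22)          ∷ (24 , costly-24′ 1≤p 1≤q) ∷ (25 , costly-25′ q≡1 1≤p) ∷ (29 , costly-29)
      ∷ (30 , costly-30 1≤q)      ∷ (33 , costly-33)          ∷ (35 , costly-35′ 1≤p 1≤q) ∷ (36 , costly-36′ p≡1 1≤q)
      ∷ [])
      where 1≤p = ≤-reflexive (sym p≡1); 1≤q = ≤-reflexive (sym q≡1)
    ... | inj₂ (inj₂ 2≤p) | inj₂ q≥1 = count-costly K T good
      ( (0 , costly-0)            ∷ (1 , costly-1 1≤p)        ∷ (2 , costly-2 2≤p)        ∷ (4 , costly-4)
      ∷ (9 , costly-9)            ∷ (10 , costly-10 1≤q)      ∷ (13 , costly-13)          ∷ (18 , costly-18)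
      ∷ (19 , costly-19 1≤p)      ∷ (20 , costly-20 2≤p)      ∷ (22 , costly-22)          ∷ (24 , costly-24′ 1≤p 1≤q)
      ∷ (29 , costly-29)          ∷ (30 , costly-30 1≤q)      ∷ (33 , costly-33)          ∷ (35 , costly-35′ 1≤p 1≤q)
      ∷ [])
      where 1≤p = <⇒≤ 2≤p; 1≤q = at-least-one q≥1
    ... | inj₂ (inj₁ p≡1) | inj₂ (inj₂ 2≤q) = count-costly K T good
      ( (0 , costly-0)            ∷ (1 , costly-1 1≤p)        ∷ (4 , costly-4)            ∷ (9 , costly-9)
      ∷ (10 , costly-10 1≤q)      ∷ (11 , costly-11 2≤q)      ∷ (13 , costly-13)          ∷ (18 , costly-18)
      ∷ (19 , costly-19 1≤p)      ∷ (22 , costly-22)          ∷ (24 , costly-24′ 1≤p 1≤q) ∷ (29 , costly-29)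
      ∷ (30 , costly-30 1≤q)      ∷ (31 , costly-31 2≤q)      ∷ (33 , costly-33)          ∷ (35 , costly-35′ 1≤p 1≤q)
      ∷ [])
      where 1≤p = ≤-reflexive (sym p≡1); 1≤q = <⇒≤ 2≤q

third-item : ∀ {n} (x y : Fin (3 + n)) → ∃[ w ] x ≢ w × y ≢ w
third-item zero             zero             = suc zero , (λ ()) , (λ ())
third-item zero             (suc zero)       = suc (suc zero) , (λ ()) , (λ ())
third-item zero             (suc (suc _))    = suc zero , (λ ()) , (λ ())
third-item (suc zero)       zero             = suc (suc zero) , (λ ()) , (λ ())
third-item (suc zero)       (suc _)          = zero , (λ ()) , (λ ())
third-item (suc (suc _))    zero             = suc zero , (λ ()) , (λ ())
third-item (suc (suc _))    (suc _)          = zero , (λ ()) , (λ ())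

lemma17 : (n : ℕ) → 3 ≤ n → (x y : Fin n) → x ≢ y →
          (M : ℕ) → 0 < M → (A : Algorithm n) → Projective A → Regular M A →
          (Mh : ℕ) → M < Mh → 3 ≤ Mh → (K T : ℕ) → 0 < K → 0 < T →
          (i j : ℕ) → Good x y Mh K T i j →
          16 ≤ sumΛ A x y Mh K T i j
lemma17 _ (s≤s (s≤s (s≤s _))) x y x≢y M _ A proj reg (suc (suc (suc e))) M<Mh (s≤s (s≤s (s≤s _))) K T _ _ i j good
  with third-item x y
... | w , x≢w , y≢w
  with Burst.threshold A M reg i x≢w | Burst.threshold A M reg j y≢w
... | p , p<M , x-threshold | q , q<M , y-threshold =
  AlongPhi.16≤sumΛ A proj M x≢y x≢w y≢w e x-threshold y-threshold (<-trans p<M M<Mh) (<-trans q<M M<Mh) {K} {T} good
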